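{- Let $t\ge0$ and $b_0,\dots,b_t\ge0$ be integers, and let $M=\{0^{(b_0)},1^{(b_1)},\dots,t^{(b_t)}\}$ be the multiset containing $b_i$ copies of $i$. Then the number of vn-arrangements of $M$ is $\prod_{i=0}^{t-1}\binom{b_i+b_{i+1}}{b_i}$.
   Context: Let $b=b_0+\dots+b_t$. A vn-arrangement of $M$ is a sequence $(v_1,\dots,v_b)$ which is an ordering of the elements of $M$ (each $i$ appearing exactly $b_i$ times) such that $v_{i+1}-v_i\le1$ for all $1\le i<b$. An empty product equals $1$. -}

module Defs where

open import Data.Nat using (ℕ; zero; suc; _+_; _*_; _≤_; _<_)
open import Data.Nat.Properties using (_≟_)
open import Data.Nat.Combinatorics using (_C_)
open import Data.List using (List; []; _∷_)
open import Data.List.Relation.Unary.All using (All)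
open import Data.Fin using (Fin; toℕ; zero; suc)
open import Relation.Nullary using (yes; no)
open import Data.Product using (_×_)
open import Relation.Binary.PropositionalEquality using (_≡_)

count : ℕ → List ℕ → ℕ
count x [] = 0
count x (y ∷ ys) with x ≟ y
... | yes _ = suc (count x ys)
... | no _  = count x ys

-- consecutive entries satisfy v_{i+1} - v_i ≤ 1, i.e. v_{i+1} ≤ v_i + 1
data StepsUp≤1 : List ℕ → Set where
  []  : StepsUp≤1 []
  [_] : ∀ x → StepsUp≤1 (x ∷ [])
  _∷_ : ∀ {x y ys} → y ≤ suc x → StepsUp≤1 (y ∷ ys) → StepsUp≤1 (x ∷ y ∷ ys)

IsOrderingOf : (t : ℕ) → (Fin (suc t) → ℕ) → List ℕ → Set
IsOrderingOf t b v = All (λ x → x < suc t) v × ((i : Fin (suc t)) → count (toℕ i) v ≡ b i)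

IsVnArrangement : (t : ℕ) → (Fin (suc t) → ℕ) → List ℕ → Set
IsVnArrangement t b v = IsOrderingOf t b v × StepsUp≤1 v

vnProduct : (t : ℕ) → (Fin (suc t) → ℕ) → ℕ
vnProduct zero    b = 1
vnProduct (suc t) b = ((b zero + b (suc zero)) C b zero) * vnProduct t (λ i → b (suc i))

module Submission where

-- Split a vn-arrangement v of {0^(b 0), …, (t+1)^(b (t+1))} into lowPart v, the binary word
-- formed by its 0s and 1s, and highPart v, the vn-arrangement of {0^(b 1), …, t^(b (t+1))}
-- obtained by deleting the 0s and lowering every other entry by one. The step condition forbids
-- anything but 0 or 1 after a 0, so each block of 0s sits at the end or directly before a 1;
-- hence v is recovered from the pair, and every pair of such a binary word (C(b 0 + b 1, b 0)
-- choices) and such a smaller arrangement occurs.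

open import Defs
open import Data.Nat using (ℕ; zero; suc; _+_; _*_; _≤_; _<_; z≤n; s≤s)
open import Data.Nat.Properties using (_≟_; ≤-trans; n≤1+n; +-suc; +-identityʳ; suc-injective)
open import Data.Nat.Combinatorics using (_C_; nCn≡1; nCk+nC[k+1]≡[n+1]C[k+1])
open import Data.Fin using (Fin; toℕ; zero; suc)
open import Data.Vec.Functional using (head; tail)
open import Data.List using (List; []; _∷_; length; map; _++_; replicate; cartesianProduct)
open import Data.List.Properties using (length-map; length-++; ∷-injectiveʳ)
open import Data.List.Membership.Propositional using (_∈_)
open import Data.List.Membership.Propositional.Properties
  using (∈-map⁺; ∈-map⁻; ∈-++⁺ˡ; ∈-++⁺ʳ; ∈-++⁻; ∈-cartesianProduct⁺; ∈-cartesianProduct⁻)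
open import Data.List.Relation.Unary.Any using (here; there)
open import Data.List.Relation.Unary.All as All using (All; []; _∷_)
open import Data.List.Relation.Unary.All.Properties using (map⁺)
open import Data.List.Relation.Unary.AllPairs using ([]; _∷_)
open import Data.List.Relation.Unary.Unique.Propositional using (Unique)
import Data.List.Relation.Unary.Unique.Propositional.Properties as Unique
open import Data.Product using (Σ; ∃; _×_; _,_; proj₁; proj₂; map₁; map₂; uncurry; <_,_>)
open import Data.Sum using (inj₁; inj₂)
open import Data.Empty using (⊥-elim)
open import Function using (_∘_)
open import Function.Bundles using (_⇔_; mk⇔)
open import Relation.Nullary using (yes; no; ¬_)
open import Relation.Binary.PropositionalEquality
  using (_≡_; _≢_; refl; sym; trans; cong; cong₂; subst; module ≡-Reasoning)

count-≢ : ∀ {x y} ys → x ≢ y → count x (y ∷ ys) ≡ count x ys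
count-≢ {x} {y} ys x≢y with x ≟ y
... | yes x≡y = ⊥-elim (x≢y x≡y)
... | no _    = refl

count-∷-cong : ∀ {k k′ x x′} {xs xs′} → (k ≡ x → k′ ≡ x′) → (k′ ≡ x′ → k ≡ x) →
               count k xs ≡ count k′ xs′ → count k (x ∷ xs) ≡ count k′ (x′ ∷ xs′)
count-∷-cong {k} {k′} {x} {x′} to from eq with k ≟ x | k′ ≟ x′
... | yes _    | yes _     = cong suc eq
... | no _     | no _      = eq
... | yes k≡x  | no k′≢x′ = ⊥-elim (k′≢x′ (to k≡x))
... | no k≢x   | yes k′≡x′ = ⊥-elim (k≢x (from k′≡x′))

length-cartesianProduct : ∀ {A B : Set} (xs : List A) (ys : List B) →
                          length (cartesianProduct xs ys) ≡ length xs * length ys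
length-cartesianProduct []       ys = refl
length-cartesianProduct (x ∷ xs) ys = begin
  length (map (x ,_) ys ++ cartesianProduct xs ys)      ≡⟨ length-++ (map (x ,_) ys) ⟩
  length (map (x ,_) ys) + length (cartesianProduct xs ys)
    ≡⟨ cong₂ _+_ (length-map (x ,_) ys) (length-cartesianProduct xs ys) ⟩
  length ys + length xs * length ys                     ∎
  where open ≡-Reasoning

Unique-map⁺-retraction : ∀ {A B : Set} {f : A → B} (g : B → A) {xs : List A} →
                         (∀ {x} → x ∈ xs → g (f x) ≡ x) → Unique xs → Unique (map f xs)
Unique-map⁺-retraction g {[]}     gf []            = []
Unique-map⁺-retraction g {x ∷ xs} gf (x∉xs ∷ xs!) =
  map⁺ (All.tabulate (λ y∈xs fx≡fy → All.lookup x∉xs y∈xs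
      (trans (sym (gf (here refl))) (trans (cong g fx≡fy) (gf (there y∈xs))))))
  ∷ Unique-map⁺-retraction g (λ x∈xs → gf (there x∈xs)) xs!

data Binary : List ℕ → Set where
  []  : Binary []
  0∷_ : ∀ {u} → Binary u → Binary (0 ∷ u)
  1∷_ : ∀ {u} → Binary u → Binary (1 ∷ u)

BinaryWord : ℕ → ℕ → List ℕ → Set
BinaryWord a b u = Binary u × count 0 u ≡ a × count 1 u ≡ b

binaryWords : ℕ → ℕ → List (List ℕ)
binaryWords zero    zero    = [] ∷ []
binaryWords zero    (suc b) = map (1 ∷_) (binaryWords zero b)
binaryWords (suc a) zero    = map (0 ∷_) (binaryWords a zero)
binaryWords (suc a) (suc b) = map (0 ∷_) (binaryWords a (suc b)) ++ map (1 ∷_) (binaryWords (suc a) b)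

0∷-binaryWord : ∀ {a b u} → BinaryWord a b u → BinaryWord (suc a) b (0 ∷ u)
0∷-binaryWord (bu , #0 , #1) = 0∷ bu , cong suc #0 , #1

1∷-binaryWord : ∀ {a b u} → BinaryWord a b u → BinaryWord a (suc b) (1 ∷ u)
1∷-binaryWord (bu , #0 , #1) = 1∷ bu , #0 , cong suc #1

∈-map-∷⁻ : ∀ {x u us} {P : List ℕ → Set} → (∀ {u′} → u′ ∈ us → P u′) →
           u ∈ map (x ∷_) us → ∃ λ u′ → u ≡ x ∷ u′ × P u′
∈-map-∷⁻ {x} f u∈ with ∈-map⁻ (x ∷_) u∈
... | u′ , u′∈ , refl = u′ , refl , f u′∈

∈-binaryWords⁻ : ∀ a b {u} → u ∈ binaryWords a b → BinaryWord a b u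
∈-binaryWords⁻ zero    zero    (here refl) = [] , refl , refl
∈-binaryWords⁻ zero    (suc b) u∈ with ∈-map-∷⁻ (∈-binaryWords⁻ zero b) u∈
... | _ , refl , bw = 1∷-binaryWord bw
∈-binaryWords⁻ (suc a) zero    u∈ with ∈-map-∷⁻ (∈-binaryWords⁻ a zero) u∈
... | _ , refl , bw = 0∷-binaryWord bw
∈-binaryWords⁻ (suc a) (suc b) u∈ with ∈-++⁻ (map (0 ∷_) (binaryWords a (suc b))) u∈
... | inj₁ u∈₀ with ∈-map-∷⁻ (∈-binaryWords⁻ a (suc b)) u∈₀
...   | _ , refl , bw = 0∷-binaryWord bw
∈-binaryWords⁻ (suc a) (suc b) u∈ | inj₂ u∈₁ with ∈-map-∷⁻ (∈-binaryWords⁻ (suc a) b) u∈₁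
...   | _ , refl , bw = 1∷-binaryWord bw

∈-binaryWords⁺ : ∀ {a b u} → BinaryWord a b u → u ∈ binaryWords a b
∈-binaryWords⁺ (bu , refl , refl) = binary-∈ bu
  where
  binary-∈ : ∀ {u} → Binary u → u ∈ binaryWords (count 0 u) (count 1 u)
  binary-∈ [] = here refl
  binary-∈ {0 ∷ u} (0∷ bu) with count 1 u | binary-∈ bu
  ... | zero  | u∈ = ∈-map⁺ (0 ∷_) u∈
  ... | suc _ | u∈ = ∈-++⁺ˡ (∈-map⁺ (0 ∷_) u∈)
  binary-∈ {1 ∷ u} (1∷ bu) with count 0 u | binary-∈ bu
  ... | zero  | u∈ = ∈-map⁺ (1 ∷_) u∈
  ... | suc a | u∈ = ∈-++⁺ʳ (map (0 ∷_) (binaryWords a _)) (∈-map⁺ (1 ∷_) u∈)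

binaryWords-unique : ∀ a b → Unique (binaryWords a b)
binaryWords-unique zero    zero    = [] ∷ []
binaryWords-unique zero    (suc b) = Unique.map⁺ ∷-injectiveʳ (binaryWords-unique zero b)
binaryWords-unique (suc a) zero    = Unique.map⁺ ∷-injectiveʳ (binaryWords-unique a zero)
binaryWords-unique (suc a) (suc b) =
  Unique.++⁺ (Unique.map⁺ ∷-injectiveʳ (binaryWords-unique a (suc b)))
             (Unique.map⁺ ∷-injectiveʳ (binaryWords-unique (suc a) b))
             disjoint
  where
  disjoint : ∀ {v} → ¬ (v ∈ map (0 ∷_) (binaryWords a (suc b)) × v ∈ map (1 ∷_) (binaryWords (suc a) b))
  disjoint (v∈₀ , v∈₁) with ∈-map⁻ (0 ∷_) v∈₀ | ∈-map⁻ (1 ∷_) v∈₁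
  ... | _ , _ , refl | _ , _ , ()

length-binaryWords : ∀ a b → length (binaryWords a b) ≡ (a + b) C a
length-binaryWords zero    zero    = refl
length-binaryWords zero    (suc b) = trans (length-map (1 ∷_) (binaryWords zero b)) (length-binaryWords zero b)
length-binaryWords (suc a) zero    = begin
  length (map (0 ∷_) (binaryWords a zero)) ≡⟨ length-map (0 ∷_) (binaryWords a zero) ⟩
  length (binaryWords a zero)              ≡⟨ length-binaryWords a zero ⟩
  (a + 0) C a                              ≡⟨ cong (_C a) (+-identityʳ a) ⟩
  a C a                                    ≡⟨ trans (nCn≡1 a) (sym (nCn≡1 (suc a))) ⟩
  suc a C suc a                            ≡⟨ cong (_C suc a) (sym (+-identityʳ (suc a))) ⟩
  (suc a + 0) C suc a                      ∎
  where open ≡-Reasoning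
length-binaryWords (suc a) (suc b) = begin
  length (map (0 ∷_) (binaryWords a (suc b)) ++ map (1 ∷_) (binaryWords (suc a) b))
    ≡⟨ length-++ (map (0 ∷_) (binaryWords a (suc b))) ⟩
  length (map (0 ∷_) (binaryWords a (suc b))) + length (map (1 ∷_) (binaryWords (suc a) b))
    ≡⟨ cong₂ _+_ (length-map (0 ∷_) (binaryWords a (suc b))) (length-map (1 ∷_) (binaryWords (suc a) b)) ⟩
  length (binaryWords a (suc b)) + length (binaryWords (suc a) b)
    ≡⟨ cong₂ _+_ (length-binaryWords a (suc b)) (length-binaryWords (suc a) b) ⟩
  (a + suc b) C a + suc (a + b) C suc a
    ≡⟨ cong (λ n → (a + suc b) C a + n C suc a) (sym (+-suc a b)) ⟩
  (a + suc b) C a + (a + suc b) C suc a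
    ≡⟨ nCk+nC[k+1]≡[n+1]C[k+1] (a + suc b) a ⟩
  suc (a + suc b) C suc a                  ∎
  where open ≡-Reasoning

-- Climb n v : v may follow an entry n − 1 without violating the step condition,
-- i.e. its head is at most n and every later entry exceeds its predecessor by at most one.
data Climb : ℕ → List ℕ → Set where
  []  : ∀ {n} → Climb n []
  _∷_ : ∀ {n x v} → x ≤ n → Climb (suc x) v → Climb n (x ∷ v)

climb-mono : ∀ {m n v} → m ≤ n → Climb m v → Climb n v
climb-mono m≤n []        = []
climb-mono m≤n (x≤m ∷ c) = ≤-trans x≤m m≤n ∷ c

stepsUp≤1-∷⇒climb : ∀ {x v} → StepsUp≤1 (x ∷ v) → Climb (suc x) v
stepsUp≤1-∷⇒climb [ x ]       = []
stepsUp≤1-∷⇒climb (y≤1+x ∷ s) = y≤1+x ∷ stepsUp≤1-∷⇒climb s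

climb⇒stepsUp≤1-∷ : ∀ {x v} → Climb (suc x) v → StepsUp≤1 (x ∷ v)
climb⇒stepsUp≤1-∷ {x} []      = [ x ]
climb⇒stepsUp≤1-∷ (y≤1+x ∷ c) = y≤1+x ∷ climb⇒stepsUp≤1-∷ c

stepsUp≤1⇒climb : ∀ {v} → StepsUp≤1 v → ∃ λ n → Climb n v
stepsUp≤1⇒climb []        = 0 , []
stepsUp≤1⇒climb {x ∷ v} s = suc x , n≤1+n x ∷ stepsUp≤1-∷⇒climb s

climb⇒stepsUp≤1 : ∀ {n v} → Climb n v → StepsUp≤1 v
climb⇒stepsUp≤1 []      = []
climb⇒stepsUp≤1 (_ ∷ c) = climb⇒stepsUp≤1-∷ c

climb-binary : ∀ {u} → Binary u → Climb 1 u
climb-binary []      = []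
climb-binary (0∷ bu) = z≤n ∷ climb-binary bu
climb-binary (1∷ bu) = s≤s z≤n ∷ climb-mono (s≤s z≤n) (climb-binary bu)

climb-replicate : ∀ {n} k → Climb n (replicate k 0)
climb-replicate zero    = []
climb-replicate (suc k) = z≤n ∷ climb-replicate k

lowPart : List ℕ → List ℕ
lowPart []                = []
lowPart (0 ∷ v)           = 0 ∷ lowPart v
lowPart (1 ∷ v)           = 1 ∷ lowPart v
lowPart (suc (suc _) ∷ v) = lowPart v

highPart : List ℕ → List ℕ
highPart []          = []
highPart (zero ∷ v)  = highPart v
highPart (suc x ∷ v) = x ∷ highPart v

-- The inverse of v ↦ (lowPart v , highPart v): the 0s of w are the 1s of v, and the 0s of u
-- that precede its k-th 1 are put directly before the k-th 1 of v (trailing 0s of u at the end).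
-- The clause for u = [] is junk: it is never reached when count 1 u ≡ count 0 w.
merge : List ℕ → List ℕ → List ℕ
merge u           []          = u
merge u           (suc x ∷ w) = suc (suc x) ∷ merge u w
merge []          (zero ∷ w)  = 1 ∷ merge [] w
merge (zero ∷ u)  (zero ∷ w)  = 0 ∷ merge u (0 ∷ w)
merge (suc _ ∷ u) (zero ∷ w)  = 1 ∷ merge u w

lowPart-binary : ∀ v → Binary (lowPart v)
lowPart-binary []                = []
lowPart-binary (0 ∷ v)           = 0∷ lowPart-binary v
lowPart-binary (1 ∷ v)           = 1∷ lowPart-binary v
lowPart-binary (suc (suc _) ∷ v) = lowPart-binary v

count₀-lowPart : ∀ v → count 0 (lowPart v) ≡ count 0 v
count₀-lowPart []                = refl
count₀-lowPart (0 ∷ v)           = cong suc (count₀-lowPart v)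
count₀-lowPart (1 ∷ v)           = count₀-lowPart v
count₀-lowPart (suc (suc _) ∷ v) = count₀-lowPart v

count₁-lowPart : ∀ v → count 1 (lowPart v) ≡ count 1 v
count₁-lowPart []                = refl
count₁-lowPart (0 ∷ v)           = count₁-lowPart v
count₁-lowPart (1 ∷ v)           = cong suc (count₁-lowPart v)
count₁-lowPart (suc (suc _) ∷ v) = count₁-lowPart v

count-highPart : ∀ k v → count k (highPart v) ≡ count (suc k) v
count-highPart k []          = refl
count-highPart k (zero ∷ v)  = trans (count-highPart k v) (sym (count-≢ {y = 0} v λ ()))
count-highPart k (suc x ∷ v) = count-∷-cong {k} {suc k} {x} {suc x} (cong suc) suc-injective (count-highPart k v)

highPart-< : ∀ {t v} → All (_< suc (suc t)) v → All (_< suc t) (highPart v)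
highPart-< []                          = []
highPart-< {v = zero ∷ _}  (_ ∷ a)      = highPart-< a
highPart-< {v = suc _ ∷ _} (s≤s x< ∷ a) = x< ∷ highPart-< a

climb-highPart : ∀ {n v} → Climb (suc n) v → Climb n (highPart v)
climb-highPart []                           = []
climb-highPart {v = zero ∷ _}  (_ ∷ c)       = climb-mono z≤n (climb-highPart c)
climb-highPart {v = suc _ ∷ _} (s≤s x≤n ∷ c) = x≤n ∷ climb-highPart c

merge-< : ∀ {t u} w → Binary u → All (_< suc t) w → All (_< suc (suc t)) (merge u w)
merge-< []          bu      []       = All.map (λ x≤1 → s≤s (≤-trans x≤1 (s≤s z≤n))) (binary-≤1 bu)
  where
  binary-≤1 : ∀ {u} → Binary u → All (_≤ 1) u
  binary-≤1 []      = []
  binary-≤1 (0∷ bu) = z≤n ∷ binary-≤1 bu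
  binary-≤1 (1∷ bu) = s≤s z≤n ∷ binary-≤1 bu
merge-< (suc x ∷ w) bu      (x< ∷ a) = s≤s x< ∷ merge-< w bu a
merge-< (zero ∷ w)  []      (x< ∷ a) = s≤s x< ∷ merge-< w [] a
merge-< (zero ∷ w)  (0∷ bu) a        = s≤s z≤n ∷ merge-< (0 ∷ w) bu a
merge-< (zero ∷ w)  (1∷ bu) (x< ∷ a) = s≤s x< ∷ merge-< w bu a

climb-merge : ∀ {n u} w → Binary u → Climb n w → Climb (suc n) (merge u w)
climb-merge []          bu      []       = climb-mono (s≤s z≤n) (climb-binary bu)
climb-merge (suc x ∷ w) bu      (x≤ ∷ c) = s≤s x≤ ∷ climb-merge w bu c
climb-merge (zero ∷ w)  []      (_ ∷ c)  = s≤s z≤n ∷ climb-merge w [] c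
climb-merge (zero ∷ w)  (0∷ bu) (_ ∷ c)  = z≤n ∷ climb-merge (0 ∷ w) bu (z≤n ∷ c)
climb-merge (zero ∷ w)  (1∷ bu) (_ ∷ c)  = s≤s z≤n ∷ climb-merge w bu c

-- After a 0 comes at most a 1, so highPart v is empty or starts with 0.
merge-0∷-highPart : ∀ u {v} → Climb 1 v → merge (0 ∷ u) (highPart v) ≡ 0 ∷ merge u (highPart v)
merge-0∷-highPart u {[]}              []           = refl
merge-0∷-highPart u {zero ∷ v}        (_ ∷ c)      = merge-0∷-highPart u c
merge-0∷-highPart u {suc zero ∷ v}    _            = refl
merge-0∷-highPart u {suc (suc _) ∷ v} (s≤s () ∷ _)

merge-lowPart-highPart : ∀ {n v} → Climb n v → merge (lowPart v) (highPart v) ≡ v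
merge-lowPart-highPart []                            = refl
merge-lowPart-highPart {v = 0 ∷ v}           (_ ∷ c) =
  trans (merge-0∷-highPart (lowPart v) c) (cong (0 ∷_) (merge-lowPart-highPart c))
merge-lowPart-highPart {v = 1 ∷ v}           (_ ∷ c) = cong (1 ∷_) (merge-lowPart-highPart c)
merge-lowPart-highPart {v = suc (suc x) ∷ v} (_ ∷ c) = cong (suc (suc x) ∷_) (merge-lowPart-highPart c)

lowPart-highPart-merge : ∀ {u} w → Binary u → count 1 u ≡ count 0 w →
                         lowPart (merge u w) ≡ u × highPart (merge u w) ≡ w
lowPart-highPart-merge []          []      _  = refl , refl
lowPart-highPart-merge []          (0∷ bu) #1 = map₁ (cong (0 ∷_)) (lowPart-highPart-merge [] bu #1)
lowPart-highPart-merge (suc x ∷ w) bu      #1 = map₂ (cong (suc x ∷_)) (lowPart-highPart-merge w bu #1)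
lowPart-highPart-merge (zero ∷ w)  (0∷ bu) #1 = map₁ (cong (0 ∷_)) (lowPart-highPart-merge (0 ∷ w) bu #1)
lowPart-highPart-merge (zero ∷ w)  (1∷ bu) #1 =
  < cong (1 ∷_) ∘ proj₁ , cong (0 ∷_) ∘ proj₂ > (lowPart-highPart-merge w bu (suc-injective #1))

all-<1⇒replicate : ∀ {v} → All (_< 1) v → v ≡ replicate (count 0 v) 0
all-<1⇒replicate []            = refl
all-<1⇒replicate (s≤s z≤n ∷ a) = cong (0 ∷_) (all-<1⇒replicate a)

replicate-isVnArrangement : ∀ b → IsVnArrangement 0 b (replicate (head b) 0)
replicate-isVnArrangement b =
  (all-<1 (head b) , λ { zero → count-replicate (head b) }) , climb⇒stepsUp≤1 (climb-replicate {0} (head b))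
  where
  all-<1 : ∀ k → All (_< 1) (replicate k 0)
  all-<1 zero    = []
  all-<1 (suc k) = s≤s z≤n ∷ all-<1 k
  count-replicate : ∀ k → count 0 (replicate k 0) ≡ k
  count-replicate zero    = refl
  count-replicate (suc k) = cong suc (count-replicate k)

isVnArrangement-0 : ∀ {b v} → IsVnArrangement 0 b v → v ≡ replicate (head b) 0
isVnArrangement-0 ((v<1 , #v) , _) = trans (all-<1⇒replicate v<1) (cong (λ k → replicate k 0) (#v zero))

lowPart-binaryWord : ∀ {t b v} → IsOrderingOf (suc t) b v → BinaryWord (head b) (head (tail b)) (lowPart v)
lowPart-binaryWord {v = v} (_ , #v) =
  lowPart-binary v , trans (count₀-lowPart v) (#v zero) , trans (count₁-lowPart v) (#v (suc zero))

highPart-isVnArrangement : ∀ {t b v} → IsVnArrangement (suc t) b v → IsVnArrangement t (tail b) (highPart v)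
highPart-isVnArrangement {v = v} ((v< , #v) , steps) =
  (highPart-< v< , λ i → trans (count-highPart (toℕ i) v) (#v (suc i))) ,
  climb⇒stepsUp≤1 (climb-highPart (climb-mono (n≤1+n _) (proj₂ (stepsUp≤1⇒climb steps))))

lowPart-highPart-merge′ : ∀ {t b u w} → BinaryWord (head b) (head (tail b)) u → IsVnArrangement t (tail b) w →
                          lowPart (merge u w) ≡ u × highPart (merge u w) ≡ w
lowPart-highPart-merge′ {w = w} (bu , _ , #1) ((_ , #w) , _) = lowPart-highPart-merge w bu (trans #1 (sym (#w zero)))

merge-isVnArrangement : ∀ {t b u w} → BinaryWord (head b) (head (tail b)) u → IsVnArrangement t (tail b) w →
                        IsVnArrangement (suc t) b (merge u w)
merge-isVnArrangement {t} {b} {u} {w} bw@(bu , #0 , _) arr@((w< , #w) , steps) =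
  (merge-< w bu w< , #merge) , climb⇒stepsUp≤1 (climb-merge w bu (proj₂ (stepsUp≤1⇒climb steps)))
  where
  open ≡-Reasoning
  inverse = lowPart-highPart-merge′ {t} {b} bw arr
  #merge : (i : Fin (suc (suc t))) → count (toℕ i) (merge u w) ≡ b i
  #merge zero = begin
    count 0 (merge u w)           ≡⟨ count₀-lowPart (merge u w) ⟨
    count 0 (lowPart (merge u w)) ≡⟨ cong (count 0) (proj₁ inverse) ⟩
    count 0 u                     ≡⟨ #0 ⟩
    b zero                        ∎
  #merge (suc i) = begin
    count (suc (toℕ i)) (merge u w)          ≡⟨ count-highPart (toℕ i) (merge u w) ⟨
    count (toℕ i) (highPart (merge u w))     ≡⟨ cong (count (toℕ i)) (proj₂ inverse) ⟩
    count (toℕ i) w                          ≡⟨ #w i ⟩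
    b (suc i)                                ∎

vnArrangements : (t : ℕ) → (Fin (suc t) → ℕ) → List (List ℕ)
vnArrangements zero    b = replicate (head b) 0 ∷ []
vnArrangements (suc t) b =
  map (uncurry merge) (cartesianProduct (binaryWords (head b) (head (tail b))) (vnArrangements t (tail b)))

∈-vnArrangements⁻ : ∀ t b {v} → v ∈ vnArrangements t b → IsVnArrangement t b v
∈-vnArrangements⁻ zero    b (here refl) = replicate-isVnArrangement b
∈-vnArrangements⁻ (suc t) b v∈ with ∈-map⁻ (uncurry merge) v∈
... | (u , w) , uw∈ , refl
  with ∈-cartesianProduct⁻ (binaryWords (head b) (head (tail b))) (vnArrangements t (tail b)) uw∈
...   | u∈ , w∈ = merge-isVnArrangement (∈-binaryWords⁻ _ _ u∈) (∈-vnArrangements⁻ t (tail b) w∈)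

∈-vnArrangements⁺ : ∀ t b {v} → IsVnArrangement t b v → v ∈ vnArrangements t b
∈-vnArrangements⁺ zero    b arr = here (isVnArrangement-0 arr)
∈-vnArrangements⁺ (suc t) b {v} arr@(ordering , steps) =
  subst (_∈ vnArrangements (suc t) b) (merge-lowPart-highPart (proj₂ (stepsUp≤1⇒climb steps)))
    (∈-map⁺ (uncurry merge) (∈-cartesianProduct⁺ lowPart∈ highPart∈))
  where
  lowPart∈ : lowPart v ∈ binaryWords (head b) (head (tail b))
  lowPart∈ = ∈-binaryWords⁺ (lowPart-binaryWord ordering)
  highPart∈ : highPart v ∈ vnArrangements t (tail b)
  highPart∈ = ∈-vnArrangements⁺ t (tail b) (highPart-isVnArrangement arr)

vnArrangements-unique : ∀ t b → Unique (vnArrangements t b)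
vnArrangements-unique zero    b = [] ∷ []
vnArrangements-unique (suc t) b =
  Unique-map⁺-retraction < lowPart , highPart > split-merge
    (Unique.cartesianProduct⁺ (binaryWords-unique (head b) (head (tail b))) (vnArrangements-unique t (tail b)))
  where
  words = binaryWords (head b) (head (tail b))
  smaller = vnArrangements t (tail b)
  split-merge : ∀ {uw} → uw ∈ cartesianProduct words smaller → < lowPart , highPart > (uncurry merge uw) ≡ uw
  split-merge uw∈ with ∈-cartesianProduct⁻ words smaller uw∈
  ... | u∈ , w∈ = uncurry (cong₂ _,_)
          (lowPart-highPart-merge′ {t} {b} (∈-binaryWords⁻ _ _ u∈) (∈-vnArrangements⁻ t (tail b) w∈))

length-vnArrangements : ∀ t b → length (vnArrangements t b) ≡ vnProduct t b
length-vnArrangements zero    b = refl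
length-vnArrangements (suc t) b = begin
  length (map (uncurry merge) (cartesianProduct words smaller)) ≡⟨ length-map (uncurry merge) (cartesianProduct words smaller) ⟩
  length (cartesianProduct words smaller)                        ≡⟨ length-cartesianProduct words smaller ⟩
  length words * length smaller
    ≡⟨ cong₂ _*_ (length-binaryWords (head b) (head (tail b))) (length-vnArrangements t (tail b)) ⟩
  vnProduct (suc t) b                                            ∎
  where
  open ≡-Reasoning
  words = binaryWords (head b) (head (tail b))
  smaller = vnArrangements t (tail b)

proposition4p1 : (t : ℕ) (b : Fin (suc t) → ℕ) →
    Σ (List (List ℕ)) λ L →
      Unique L × ((v : List ℕ) → (v ∈ L ⇔ IsVnArrangement t b v)) × (length L ≡ vnProduct t b)
proposition4p1 t b =
  vnArrangements t b ,
  vnArrangements-unique t b ,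
  (λ v → mk⇔ (∈-vnArrangements⁻ t b) (∈-vnArrangements⁺ t b)) ,
  length-vnArrangements t b
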